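{- Let $n\ge2$. Every connected component of the graph $\mathcal{G}_n$ is isomorphic to a hypercube graph $\mathcal{H}_\ell$ for some $\ell\ge0$.
   Context: An $n$-signature is a tuple of integers $(n,b_s,\dots,b_1)$ with $n=b_{s+1}>b_s>\dots>b_1=1$ and $b_{j+1}\le 2b_j$ for $j=1,\dots,s$. The tower of a signature consists of $n-1$ cells at heights $1,\dots,n-1$, partitioned into blocks: the $j$-th block consists of the cells at heights $b_j,\dots,b_{j+1}-1$, with position $b_j$. An array associated to the signature is an assignment of a positive integer to each cell such that the numbers in the $j$-th block belong to $\{1,\dots,b_j\}$ and are strictly decreasing as the height increases. An $n$-array is a pair (signature, array associated to it). A split of an array divides one block having at least two cells into two consecutive nonempty blocks (each new block has as position the height of its lowest cell), keeping all cell entries; a merge is the reverse operation (combining two consecutive blocks whose entries together are strictly decreasing upward). The graph $\mathcal{G}_n$ has the $n$-arrays as vertices, two arrays being adjacent when one is obtained from the other by a single split (equivalently, merge). The hypercube graph $\mathcal{H}_\ell$ has vertex set $\{0,1\}^\ell$, two vertices being adjacent when they differ in exactly one coordinate. -}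

module Defs where

open import Data.Nat using (ℕ; _+_; _*_; _≤_; _<_; _>_)
open import Data.Bool using (Bool)
open import Data.Fin using (Fin)
open import Data.List using (List; []; _∷_; _++_; length)
open import Data.List.Relation.Unary.All using (All)
open import Data.List.Relation.Unary.Linked using (Linked)
open import Data.Vec using (Vec; lookup)
open import Data.Product using (Σ; _×_; ∃)
open import Data.Sum using (_⊎_)
open import Relation.Binary.PropositionalEquality using (_≡_; _≢_)
open import Relation.Binary.Construct.Closure.ReflexiveTransitive using (Star)
open import Function.Definitions using (Injective)
open import Function.Bundles using (_⇔_)

-- A (raw) array is the list of its blocks, from the bottom block to the top
-- block; each block is the list of its cell entries, from the lowest cell
-- (height = position of the block) upwards.  The signature is determined by
-- the block lengths: the position of a block is 1 + (number of cells below).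
Array : Set
Array = List (List ℕ)

-- ValidFrom p n bs : the blocks bs, the first of which has position p,
-- form a valid tail of an n-array.
ValidFrom : ℕ → ℕ → Array → Set
ValidFrom p n []       = p ≡ n
ValidFrom p n (B ∷ Bs) =
  (1 ≤ length B)
  × All (λ a → 1 ≤ a × a ≤ p) B
  × Linked _>_ B
  × (p + length B ≤ 2 * p)
  × ValidFrom (p + length B) n Bs

IsArray : ℕ → Array → Set
IsArray n bs = ValidFrom 1 n bs

Split : Array → Array → Set
Split x y = Σ Array λ pre → Σ (List ℕ) λ B → Σ (List ℕ) λ C → Σ Array λ post →
  (1 ≤ length B) × (1 ≤ length C)
  × (x ≡ pre ++ ((B ++ C) ∷ post))
  × (y ≡ pre ++ (B ∷ C ∷ post))

Adj : ℕ → Array → Array → Set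
Adj n x y = IsArray n x × IsArray n y × (Split x y ⊎ Split y x)

HAdj : {ℓ : ℕ} → Vec Bool ℓ → Vec Bool ℓ → Set
HAdj {ℓ} u v = Σ (Fin ℓ) λ i →
  (lookup u i ≢ lookup v i) × (∀ j → j ≢ i → lookup u j ≡ lookup v j)

IsoOntoComponent : ℕ → Array → (ℓ : ℕ) → (Vec Bool ℓ → Array) → Set
IsoOntoComponent n x ℓ f =
  Injective _≡_ _≡_ f
  × (∀ v → Star (Adj n) x (f v))
  × (∀ y → Star (Adj n) x y → ∃ λ v → f v ≡ y)
  × (∀ u v → Adj n (f u) (f v) ⇔ HAdj u v)

-- Record an n-array by its entries, read from the bottom cell upwards, together with
-- a flag on every cell above the first saying whether a new block starts there.
-- A split or a merge changes exactly one flag and keeps the entries.  Validity is a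
-- condition on each cell separately: a cell at height h with entry a, lying above a
-- cell with entry p, may start a block iff a ≤ h and may continue one iff a < p.
-- (The doubling condition is automatic: a strictly decreasing block of entries in
-- {1,…,b} has at most b cells.)  So for fixed entries each flag is either forced or
-- free, and the component is the hypercube on the free flags.
module Submission where

open import Defs
open import Data.Nat using (ℕ; zero; suc; _+_; _*_; _≤_; _<_; _>_; z≤n; s≤s)
open import Data.Nat.Properties
  using (_≤?_; ≤-refl; ≤-trans; <⇒≤; <⇒≱; ≰⇒>; ≤-antisym; +-suc; +-identityʳ; +-monoʳ-≤)
open import Data.Bool using (Bool; true; false)
import Data.Bool.Properties as Bool
open import Data.Fin using (zero; suc)
open import Data.Fin.Properties using (suc-injective)
open import Data.Vec using (Vec; []; _∷_; lookup; tabulate)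
open import Data.Vec.Properties using (tabulate∘lookup; tabulate-cong)
open import Data.List using (List; []; _∷_; _++_; length; map)
open import Data.List.Properties using (∷-injectiveˡ; ∷-injectiveʳ)
import Data.List.Relation.Unary.All as All
open All using (All; []; _∷_)
open import Data.List.Relation.Unary.Linked using (Linked; [-]; _∷_)
open import Data.Product using (Σ; _×_; _,_; proj₁; proj₂; ∃)
open import Data.Sum using (_⊎_; inj₁; inj₂)
import Data.Sum as Sum
open import Data.Empty using (⊥-elim)
open import Function using (_∘_)
open import Function.Bundles using (_⇔_; mk⇔; Equivalence)
import Function.Properties.Equivalence as ⇔
open import Relation.Nullary using (¬_; yes; no)
open import Relation.Binary.PropositionalEquality
  using (_≡_; _≢_; refl; sym; trans; cong; cong₂; subst; subst₂; module ≡-Reasoning)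
open import Relation.Binary.Construct.Closure.ReflexiveTransitive using (Star; ε; _◅_; _◅◅_; gmap)

open Equivalence using (to; from)

-- The cells of an array above its first one, from bottom to top: each cell is its
-- entry together with the flag "a new block starts here".
Cells : Set
Cells = List (ℕ × Bool)

entries : Cells → List ℕ
entries = map proj₁

continuing : List ℕ → Cells
continuing = map (_, false)

-- The remaining entries of the block containing the cell just below, and the blocks above.
blocksOf : Cells → List ℕ × Array
blocksOf []                = [] , []
blocksOf ((a , true)  ∷ c) = [] , (a ∷ proj₁ (blocksOf c)) ∷ proj₂ (blocksOf c)
blocksOf ((a , false) ∷ c) = a ∷ proj₁ (blocksOf c) , proj₂ (blocksOf c)

toArray : ℕ → Cells → Array
toArray a c = (a ∷ proj₁ (blocksOf c)) ∷ proj₂ (blocksOf c)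

blockCells : List ℕ → Cells
blockCells []      = []
blockCells (a ∷ B) = (a , true) ∷ continuing B

toCells : Array → Cells
toCells []       = []
toCells (B ∷ Bs) = blockCells B ++ toCells Bs

continuing-blocksOf : ∀ c → continuing (proj₁ (blocksOf c)) ++ toCells (proj₂ (blocksOf c)) ≡ c
continuing-blocksOf []                = refl
continuing-blocksOf ((a , true)  ∷ c) = cong ((a , true) ∷_) (continuing-blocksOf c)
continuing-blocksOf ((a , false) ∷ c) = cong ((a , false) ∷_) (continuing-blocksOf c)

toCells-toArray : ∀ a c → toCells (toArray a c) ≡ (a , true) ∷ c
toCells-toArray a c = cong ((a , true) ∷_) (continuing-blocksOf c)

toArray-injective : ∀ a {c d} → toArray a c ≡ toArray a d → c ≡ d
toArray-injective a {c} {d} eq = ∷-injectiveʳ (begin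
  (a , true) ∷ c        ≡⟨ toCells-toArray a c ⟨
  toCells (toArray a c) ≡⟨ cong toCells eq ⟩
  toCells (toArray a d) ≡⟨ toCells-toArray a d ⟩
  (a , true) ∷ d        ∎)
  where open ≡-Reasoning

blocksOf-continuing : ∀ R Bs → All (λ B → 1 ≤ length B) Bs →
                      blocksOf (continuing R ++ toCells Bs) ≡ (R , Bs)
blocksOf-continuing (r ∷ R) Bs nonEmpty =
  cong (λ (R′ , Bs′) → r ∷ R′ , Bs′) (blocksOf-continuing R Bs nonEmpty)
blocksOf-continuing [] []               []            = refl
blocksOf-continuing [] ((a ∷ B) ∷ Bs) (_ ∷ nonEmpty) =
  cong (λ (B′ , Bs′) → [] , (a ∷ B′) ∷ Bs′) (blocksOf-continuing B Bs nonEmpty)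

data RaiseFlag : Cells → Cells → Set where
  here  : ∀ {a c} → RaiseFlag ((a , false) ∷ c) ((a , true) ∷ c)
  there : ∀ {x c d} → RaiseFlag c d → RaiseFlag (x ∷ c) (x ∷ d)

raiseFlag-entries : ∀ {c d} → RaiseFlag c d → entries c ≡ entries d
raiseFlag-entries here      = refl
raiseFlag-entries (there r) = cong (_ ∷_) (raiseFlag-entries r)

raiseFlag-tail : ∀ {x c d} → RaiseFlag (x ∷ c) (x ∷ d) → RaiseFlag c d
raiseFlag-tail (there r) = r

raiseFlag-∷⁻ : ∀ {a s t c d} → RaiseFlag ((a , s) ∷ c) ((a , t) ∷ d) →
               (s ≡ false × t ≡ true × c ≡ d) ⊎ (s ≡ t × RaiseFlag c d)
raiseFlag-∷⁻ here      = inj₁ (refl , refl , refl)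
raiseFlag-∷⁻ (there r) = inj₂ (refl , r)

raiseFlag-++ : ∀ e {c d} → RaiseFlag c d → RaiseFlag (e ++ c) (e ++ d)
raiseFlag-++ []      r = r
raiseFlag-++ (x ∷ e) r = there (raiseFlag-++ e r)

raiseFlag-continuing : ∀ B c C e →
  RaiseFlag (continuing (B ++ c ∷ C) ++ e) (continuing B ++ (c , true) ∷ continuing C ++ e)
raiseFlag-continuing []      c C e = here
raiseFlag-continuing (b ∷ B) c C e = there (raiseFlag-continuing B c C e)

data Splits : Array → Array → Set where
  here  : ∀ {B C post} → 1 ≤ length B → 1 ≤ length C → Splits ((B ++ C) ∷ post) (B ∷ C ∷ post)
  there : ∀ {B x y} → Splits x y → Splits (B ∷ x) (B ∷ y)

split⇒splits : ∀ {x y} → Split x y → Splits x y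
split⇒splits ([] , _ , _ , _ , 1≤B , 1≤C , refl , refl) = here 1≤B 1≤C
split⇒splits (_ ∷ pre , B , C , post , 1≤B , 1≤C , refl , refl) =
  there (split⇒splits (pre , B , C , post , 1≤B , 1≤C , refl , refl))

splits⇒split : ∀ {x y} → Splits x y → Split x y
splits⇒split (here {B} {C} {post} 1≤B 1≤C) = [] , B , C , post , 1≤B , 1≤C , refl , refl
splits⇒split (there {A} s) with splits⇒split s
... | pre , B , C , post , 1≤B , 1≤C , refl , refl = A ∷ pre , B , C , post , 1≤B , 1≤C , refl , refl

splits⇒raiseFlag : ∀ {x y} → Splits x y → RaiseFlag (toCells x) (toCells y)
splits⇒raiseFlag (here {[]} () _)
splits⇒raiseFlag (here {_ ∷ _} {[]} _ ())
splits⇒raiseFlag (here {b ∷ B} {c ∷ C} {post} _ _) = there (raiseFlag-continuing B c C (toCells post))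
splits⇒raiseFlag (there {B} s) = raiseFlag-++ (blockCells B) (splits⇒raiseFlag s)

addBottom : ℕ → Array → Array
addBottom a []       = []
addBottom a (B ∷ Bs) = (a ∷ B) ∷ Bs

splits-addBottom : ∀ a {x y} → Splits x y → Splits (addBottom a x) (addBottom a y)
splits-addBottom a (here _ 1≤C) = here (s≤s z≤n) 1≤C
splits-addBottom a (there s)    = there s

raiseFlag⇒splits : ∀ a {c d} → RaiseFlag c d → Splits (toArray a c) (toArray a d)
raiseFlag⇒splits a here                  = here (s≤s z≤n) (s≤s z≤n)
raiseFlag⇒splits a (there {e , true} r)  = there (raiseFlag⇒splits e r)
raiseFlag⇒splits a (there {e , false} r) = splits-addBottom a (raiseFlag⇒splits e r)

split⇔raiseFlag : ∀ a {c d} → Split (toArray a c) (toArray a d) ⇔ RaiseFlag c d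
split⇔raiseFlag a {c} {d} = mk⇔
  (λ s → raiseFlag-tail (subst₂ RaiseFlag (toCells-toArray a c) (toCells-toArray a d)
                                            (splits⇒raiseFlag (split⇒splits s))))
  (splits⇒split ∘ raiseFlag⇒splits a)

data RaiseBit : ∀ {m} → Vec Bool m → Vec Bool m → Set where
  here  : ∀ {m} {u : Vec Bool m} → RaiseBit (false ∷ u) (true ∷ u)
  there : ∀ {m b} {u v : Vec Bool m} → RaiseBit u v → RaiseBit (b ∷ u) (b ∷ v)

HAdj-sym : ∀ {m} {u v : Vec Bool m} → HAdj u v → HAdj v u
HAdj-sym (i , differ , agree) = i , differ ∘ sym , λ j j≢i → sym (agree j j≢i)

HAdj-here : ∀ {m s t} {u : Vec Bool m} → s ≢ t → HAdj (s ∷ u) (t ∷ u)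
HAdj-here s≢t = zero , s≢t , λ { zero 0≢0 → ⊥-elim (0≢0 refl) ; (suc j) _ → refl }

HAdj-there : ∀ {m b} {u v : Vec Bool m} → HAdj u v → HAdj (b ∷ u) (b ∷ v)
HAdj-there (i , differ , agree) =
  suc i , differ , λ { zero _ → refl ; (suc j) j≢i → agree j (j≢i ∘ cong suc) }

raiseBit⇒HAdj : ∀ {m} {u v : Vec Bool m} → RaiseBit u v → HAdj u v
raiseBit⇒HAdj here      = HAdj-here λ ()
raiseBit⇒HAdj (there r) = HAdj-there (raiseBit⇒HAdj r)

lookup-injective : ∀ {A : Set} {m} {u v : Vec A m} → (∀ i → lookup u i ≡ lookup v i) → u ≡ v
lookup-injective {u = u} {v} same = begin
  u                   ≡⟨ tabulate∘lookup u ⟨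
  tabulate (lookup u) ≡⟨ tabulate-cong same ⟩
  tabulate (lookup v) ≡⟨ tabulate∘lookup v ⟩
  v                   ∎
  where open ≡-Reasoning

HAdj⇒raiseBit : ∀ {m} (u v : Vec Bool m) → HAdj u v → RaiseBit u v ⊎ RaiseBit v u
HAdj⇒raiseBit (s ∷ u) (t ∷ v) (zero , s≢t , agree)
  with lookup-injective {u = u} {v} (λ j → agree (suc j) (λ ()))
HAdj⇒raiseBit (false ∷ u) (true ∷ u)  (zero , _ , _)   | refl = inj₁ here
HAdj⇒raiseBit (true ∷ u)  (false ∷ u) (zero , _ , _)   | refl = inj₂ here
HAdj⇒raiseBit (false ∷ u) (false ∷ u) (zero , s≢t , _) | refl = ⊥-elim (s≢t refl)
HAdj⇒raiseBit (true ∷ u)  (true ∷ u)  (zero , s≢t , _) | refl = ⊥-elim (s≢t refl)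
HAdj⇒raiseBit (s ∷ u) (t ∷ v) (suc i , differ , agree) with agree zero (λ ())
... | refl = Sum.map there there
  (HAdj⇒raiseBit u v (i , differ , λ j j≢i → agree (suc j) (j≢i ∘ suc-injective)))

HAdj-connected : ∀ {m} (u v : Vec Bool m) → Star HAdj u v
HAdj-connected []      []      = ε
HAdj-connected (s ∷ u) (t ∷ v) = gmap (s ∷_) HAdj-there (HAdj-connected u v) ◅◅ changeHead
  where
  changeHead : Star HAdj (s ∷ v) (t ∷ v)
  changeHead with s Bool.≟ t
  ... | yes refl = ε
  ... | no s≢t   = HAdj-here s≢t ◅ ε

-- A cell at height h with entry a, just above a cell with entry p.
FlagAllowed : (h p a : ℕ) → Bool → Set
FlagAllowed h p a true  = a ≤ h
FlagAllowed h p a false = a < p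

data Kind : Set where
  opens continues free : Kind

kind : (h p a : ℕ) → Kind
kind h p a with p ≤? a | a ≤? h
... | yes _ | _     = opens
... | no _  | yes _ = free
... | no _  | no _  = continues

data Classified (h p a : ℕ) : Kind → Set where
  opens     : ¬ FlagAllowed h p a false → Classified h p a opens
  continues : ¬ FlagAllowed h p a true → Classified h p a continues
  free      : (∀ t → FlagAllowed h p a t) → Classified h p a free

classify : ∀ h p a → Classified h p a (kind h p a)
classify h p a with p ≤? a | a ≤? h
... | yes p≤a | _       = opens (λ a<p → <⇒≱ a<p p≤a)
... | no p≰a  | yes a≤h = free λ { true → a≤h ; false → ≰⇒> p≰a }
... | no _    | no a≰h  = continues a≰h

countFree : Kind → ℕ → ℕ
countFree free      m = suc m
countFree opens     m = m
countFree continues m = m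

dimension : (h p : ℕ) → List ℕ → ℕ
dimension h p []       = 0
dimension h p (a ∷ es) = countFree (kind h p a) (dimension (suc h) a es)

cellsOf : (h p : ℕ) (es : List ℕ) → Vec Bool (dimension h p es) → Cells
cellsOf h p []       []  = []
cellsOf h p (a ∷ es) v with kind h p a
cellsOf h p (a ∷ es) v       | opens     = (a , true) ∷ cellsOf (suc h) a es v
cellsOf h p (a ∷ es) v       | continues = (a , false) ∷ cellsOf (suc h) a es v
cellsOf h p (a ∷ es) (t ∷ v) | free      = (a , t) ∷ cellsOf (suc h) a es v

entries-cellsOf : ∀ h p es v → entries (cellsOf h p es v) ≡ es
entries-cellsOf h p []       []  = refl
entries-cellsOf h p (a ∷ es) v with kind h p a
entries-cellsOf h p (a ∷ es) v       | opens     = cong (a ∷_) (entries-cellsOf (suc h) a es v)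
entries-cellsOf h p (a ∷ es) v       | continues = cong (a ∷_) (entries-cellsOf (suc h) a es v)
entries-cellsOf h p (a ∷ es) (_ ∷ v) | free      = cong (a ∷_) (entries-cellsOf (suc h) a es v)

cellsOf-injective : ∀ h p es {u v} → cellsOf h p es u ≡ cellsOf h p es v → u ≡ v
cellsOf-injective h p [] {[]} {[]} _ = refl
cellsOf-injective h p (a ∷ es) {u} {v} eq with kind h p a
... | opens     = cellsOf-injective (suc h) a es (∷-injectiveʳ eq)
... | continues = cellsOf-injective (suc h) a es (∷-injectiveʳ eq)
cellsOf-injective h p (a ∷ es) {s ∷ u} {t ∷ v} eq | free =
  cong₂ _∷_ (cong proj₂ (∷-injectiveˡ eq)) (cellsOf-injective (suc h) a es (∷-injectiveʳ eq))

raiseFlag⇒raiseBit : ∀ h p es {u v} → RaiseFlag (cellsOf h p es u) (cellsOf h p es v) → RaiseBit u v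
raiseFlag⇒raiseBit h p [] {[]} {[]} ()
raiseFlag⇒raiseBit h p (a ∷ es) r with kind h p a
raiseFlag⇒raiseBit h p (a ∷ es) (there r) | opens     = raiseFlag⇒raiseBit (suc h) a es r
raiseFlag⇒raiseBit h p (a ∷ es) (there r) | continues = raiseFlag⇒raiseBit (suc h) a es r
raiseFlag⇒raiseBit h p (a ∷ es) {_ ∷ u} {_ ∷ v} r | free with raiseFlag-∷⁻ r
... | inj₁ (refl , refl , eq) with cellsOf-injective (suc h) a es eq
...   | refl = here
raiseFlag⇒raiseBit h p (a ∷ es) {_ ∷ u} {_ ∷ v} r | free | inj₂ (refl , r′) =
  there (raiseFlag⇒raiseBit (suc h) a es r′)

raiseBit⇒raiseFlag : ∀ h p es {u v} → RaiseBit u v → RaiseFlag (cellsOf h p es u) (cellsOf h p es v)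
raiseBit⇒raiseFlag h p [] {[]} ()
raiseBit⇒raiseFlag h p (a ∷ es) r with kind h p a
... | opens     = there (raiseBit⇒raiseFlag (suc h) a es r)
... | continues = there (raiseBit⇒raiseFlag (suc h) a es r)
raiseBit⇒raiseFlag h p (a ∷ es) here      | free = here
raiseBit⇒raiseFlag h p (a ∷ es) (there r) | free = there (raiseBit⇒raiseFlag (suc h) a es r)

InBlock : ℕ → ℕ → Set
InBlock b a = 1 ≤ a × a ≤ b

length<head : ∀ {a} R → All (1 ≤_) R → Linked _>_ (a ∷ R) → 1 ≤ a → length R < a
length<head []      _              _            1≤a = 1≤a
length<head (r ∷ R) (1≤r ∷ 1≤R) (r<a ∷ decr) _   = ≤-trans (s≤s (length<head R 1≤R decr 1≤r)) r<a

n≤m⇒m+n≤2*m : ∀ m {n} → n ≤ m → m + n ≤ 2 * m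
n≤m⇒m+n≤2*m m n≤m rewrite +-identityʳ m = +-monoʳ-≤ m n≤m

module _ (n : ℕ) where

  -- h is the height of the first cell of the list and p the entry of the cell below it.
  ValidCells : (h p : ℕ) → Cells → Set
  ValidCells h p []            = h ≡ n
  ValidCells h p ((a , t) ∷ c) = 1 ≤ a × FlagAllowed h p a t × ValidCells (suc h) a c

  atPosition : ∀ {p q Bs} → p ≡ q → ValidFrom p n Bs → ValidFrom q n Bs
  atPosition {Bs = Bs} = subst (λ p → ValidFrom p n Bs)

  -- The block containing the cell below has position b and top entry a so far.
  ValidOpen : (h b a : ℕ) → List ℕ × Array → Set
  ValidOpen h b a (R , Bs) = Linked _>_ (a ∷ R) × All (InBlock b) R × ValidFrom (h + length R) n Bs

  blocksOf-valid : ∀ {h b a} c → a ≤ b → ValidCells h a c → ValidOpen h b a (blocksOf c)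
  blocksOf-valid {h} [] _ h≡n = [-] , [] , trans (+-identityʳ h) h≡n
  blocksOf-valid {h} ((a′ , true) ∷ c) _ (1≤a′ , a′≤h , valid)
    with blocksOf-valid c a′≤h valid
  ... | decr , inBlock , rest =
    [-] , [] , atPosition (sym (+-identityʳ h))
      ( s≤s z≤n , (1≤a′ , a′≤h) ∷ inBlock , decr
      , n≤m⇒m+n≤2*m h (≤-trans (length<head _ (All.map proj₁ inBlock) decr 1≤a′) a′≤h)
      , atPosition (sym (+-suc h _)) rest)
  blocksOf-valid {h} ((a′ , false) ∷ c) a≤b (1≤a′ , a′<a , valid)
    with blocksOf-valid c (≤-trans (<⇒≤ a′<a) a≤b) valid
  ... | decr , inBlock , rest =
    a′<a ∷ decr , (1≤a′ , ≤-trans (<⇒≤ a′<a) a≤b) ∷ inBlock , atPosition (sym (+-suc h _)) rest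

  toArray-valid : ∀ c → ValidCells 2 1 c → IsArray n (toArray 1 c)
  toArray-valid c valid with blocksOf-valid c ≤-refl valid
  ... | decr , inBlock , rest =
    s≤s z≤n , (s≤s z≤n , s≤s z≤n) ∷ inBlock , decr
    , s≤s (length<head _ (All.map proj₁ inBlock) decr (s≤s z≤n)) , rest

  continuing-valid : ∀ {h b a} R Bs → Linked _>_ (a ∷ R) → All (InBlock b) R →
                     ValidFrom (h + length R) n Bs → ValidCells h a (continuing R ++ toCells Bs)
  continuing-valid {h} (r ∷ R) Bs (r<a ∷ decr) ((1≤r , _) ∷ inBlock) rest =
    1≤r , r<a , continuing-valid R Bs decr inBlock (atPosition (+-suc h _) rest)
  continuing-valid {h} [] [] _ _ h≡n = trans (sym (+-identityʳ h)) h≡n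
  continuing-valid {h} [] ((a ∷ B) ∷ Bs) _ _ rest with atPosition (+-identityʳ h) rest
  ... | _ , (1≤a , a≤h) ∷ inBlock , decr , _ , rest′ =
    1≤a , a≤h , continuing-valid B Bs decr inBlock (atPosition (+-suc h _) rest′)
  continuing-valid {h} [] ([] ∷ Bs) _ _ rest with atPosition (+-identityʳ h) rest
  ... | () , _

  validFrom-nonEmpty : ∀ {p} Bs → ValidFrom p n Bs → All (λ B → 1 ≤ length B) Bs
  validFrom-nonEmpty []       _                         = []
  validFrom-nonEmpty (B ∷ Bs) (1≤B , _ , _ , _ , rest) = 1≤B ∷ validFrom-nonEmpty Bs rest

  -- The bottom entry is 1, so the first cell never needs to be stored.
  arrayCells : 2 ≤ n → ∀ x → IsArray n x → Σ Cells λ c → ValidCells 2 1 c × x ≡ toArray 1 c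
  arrayCells (s≤s ()) [] refl
  arrayCells _ ([] ∷ Bs) (() , _)
  arrayCells _ ((a ∷ R) ∷ Bs) (_ , (1≤a , a≤1) ∷ inBlock , decr , _ , rest)
    with ≤-antisym a≤1 1≤a
  ... | refl =
    continuing R ++ toCells Bs , continuing-valid R Bs decr inBlock rest
    , sym (cong (λ (R′ , Bs′) → (1 ∷ R′) ∷ Bs′)
                (blocksOf-continuing R Bs (validFrom-nonEmpty Bs rest)))

  cellsOf-valid : ∀ {h p} c → ValidCells h p c → ∀ v → ValidCells h p (cellsOf h p (entries c) v)
  cellsOf-valid [] valid [] = valid
  cellsOf-valid {h} {p} ((a , t) ∷ c) (1≤a , allowed , valid) v with kind h p a | classify h p a
  cellsOf-valid ((a , true) ∷ c) (1≤a , allowed , valid) v | opens | _ =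
    1≤a , allowed , cellsOf-valid c valid v
  cellsOf-valid ((a , false) ∷ c) (_ , allowed , _) v | opens | opens ¬continue =
    ⊥-elim (¬continue allowed)
  cellsOf-valid ((a , false) ∷ c) (1≤a , allowed , valid) v | continues | _ =
    1≤a , allowed , cellsOf-valid c valid v
  cellsOf-valid ((a , true) ∷ c) (_ , allowed , _) v | continues | continues ¬open =
    ⊥-elim (¬open allowed)
  cellsOf-valid ((a , t) ∷ c) (1≤a , _ , valid) (s ∷ v) | free | free allowed =
    1≤a , allowed s , cellsOf-valid c valid v

  cellsOf-onto : ∀ {h p} c → ValidCells h p c → Σ (Vec Bool (dimension h p (entries c))) λ v →
                 cellsOf h p (entries c) v ≡ c
  cellsOf-onto [] _ = [] , refl
  cellsOf-onto {h} {p} ((a , t) ∷ c) (_ , allowed , valid)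
    with cellsOf-onto c valid | kind h p a | classify h p a
  cellsOf-onto ((a , true) ∷ c) _ | v , eq | opens | _ = v , cong ((a , true) ∷_) eq
  cellsOf-onto ((a , false) ∷ c) (_ , allowed , _) | _ | opens | opens ¬continue =
    ⊥-elim (¬continue allowed)
  cellsOf-onto ((a , false) ∷ c) _ | v , eq | continues | _ = v , cong ((a , false) ∷_) eq
  cellsOf-onto ((a , true) ∷ c) (_ , allowed , _) | _ | continues | continues ¬open =
    ⊥-elim (¬open allowed)
  cellsOf-onto ((a , t) ∷ c) _ | v , eq | free | _ = t ∷ v , cong ((a , t) ∷_) eq

cube : (es : List ℕ) → Vec Bool (dimension 2 1 es) → Array
cube es v = toArray 1 (cellsOf 2 1 es v)

cube-injective : ∀ es {u v} → cube es u ≡ cube es v → u ≡ v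
cube-injective es = cellsOf-injective 2 1 es ∘ toArray-injective 1

split⇔raiseBit : ∀ es {u v} → Split (cube es u) (cube es v) ⇔ RaiseBit u v
split⇔raiseBit es =
  ⇔.trans (split⇔raiseFlag 1) (mk⇔ (raiseFlag⇒raiseBit 2 1 es) (raiseBit⇒raiseFlag 2 1 es))

module _ {n : ℕ} {c : Cells} (valid : ValidCells n 2 1 c) where

  cube-valid : ∀ v → IsArray n (cube (entries c) v)
  cube-valid v = toArray-valid n _ (cellsOf-valid n c valid v)

  cube-adj : ∀ u v → Adj n (cube (entries c) u) (cube (entries c) v) ⇔ HAdj u v
  cube-adj u v = mk⇔ toHAdj fromHAdj
    where
    split⇔ : ∀ {u v} → Split (cube (entries c) u) (cube (entries c) v) ⇔ RaiseBit u v
    split⇔ = split⇔raiseBit (entries c)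
    toHAdj : Adj n (cube (entries c) u) (cube (entries c) v) → HAdj u v
    toHAdj (_ , _ , inj₁ s) = raiseBit⇒HAdj (to split⇔ s)
    toHAdj (_ , _ , inj₂ s) = HAdj-sym {u = v} {u} (raiseBit⇒HAdj (to split⇔ s))
    fromHAdj : HAdj u v → Adj n (cube (entries c) u) (cube (entries c) v)
    fromHAdj adj = cube-valid u , cube-valid v , Sum.map (from split⇔) (from split⇔) (HAdj⇒raiseBit u v adj)

  cube-connected : ∀ u v → Star (Adj n) (cube (entries c) u) (cube (entries c) v)
  cube-connected u v = gmap (cube (entries c)) (from (cube-adj _ _)) (HAdj-connected u v)

cube-onto : ∀ {n es} c → ValidCells n 2 1 c → entries c ≡ es → ∃ λ v → cube es v ≡ toArray 1 c
cube-onto {n} c valid refl with cellsOf-onto n c valid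
... | v , eq = v , cong (toArray 1) eq

module _ {n : ℕ} (2≤n : 2 ≤ n) where

  cube-closed : ∀ es {v y} → Adj n (cube es v) y → ∃ λ w → cube es w ≡ y
  cube-closed es {v} (_ , y-valid , split) with arrayCells n 2≤n _ y-valid
  ... | d , d-valid , refl = cube-onto d d-valid (begin
    entries d                   ≡⟨ sameEntries split ⟨
    entries (cellsOf 2 1 es v)  ≡⟨ entries-cellsOf 2 1 es v ⟩
    es                          ∎)
    where
    open ≡-Reasoning
    sameEntries : Split (cube es v) (toArray 1 d) ⊎ Split (toArray 1 d) (cube es v) →
                  entries (cellsOf 2 1 es v) ≡ entries d
    sameEntries (inj₁ s) = raiseFlag-entries (to (split⇔raiseFlag 1) s)
    sameEntries (inj₂ s) = sym (raiseFlag-entries (to (split⇔raiseFlag 1) s))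

  reachable⇒cube : ∀ es {v y} → Star (Adj n) (cube es v) y → ∃ λ w → cube es w ≡ y
  reachable⇒cube es ε = _ , refl
  reachable⇒cube es (adj ◅ path) with cube-closed es adj
  ... | w , refl = reachable⇒cube es path

lemma4 : (n : ℕ) → 2 ≤ n → (x : Array) → IsArray n x →
    Σ ℕ λ ℓ → Σ (Vec Bool ℓ → Array) λ f → IsoOntoComponent n x ℓ f
lemma4 n 2≤n x x-valid with arrayCells n 2≤n x x-valid
... | c , valid , refl with cube-onto c valid refl
... | v₀ , v₀↦x =
  dimension 2 1 (entries c) , cube (entries c) , cube-injective (entries c)
  , (λ v → subst (λ z → Star (Adj n) z (cube (entries c) v)) v₀↦x (cube-connected valid v₀ v))
  , (λ y → reachable⇒cube 2≤n (entries c) ∘ subst (λ z → Star (Adj n) z y) (sym v₀↦x))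
  , cube-adj valid
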